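{- Let $G$ be a chordal graph. Then $\mathrm{Mand}(G)$ is a monitoring edge-geodetic set of $G$. (Consequently, $\mathrm{Mand}(G)$ is the unique minimum monitoring edge-geodetic set of $G$.)
   Context: Graphs are finite and simple. For a graph $G=(V,E)$, an edge $e\in E$ and vertices $a,b\in V$, the pair $\{a,b\}$ monitors $e$ if $e$ lies on every shortest path between $a$ and $b$. A set $M\subseteq V$ monitors $e$ if some two vertices of $M$ monitor $e$. A monitoring edge-geodetic set (meg-set) of $G$ is a set $M\subseteq V$ that monitors every edge of $G$. A vertex is mandatory if it belongs to every meg-set of $G$, and $\mathrm{Mand}(G)$ denotes the set of mandatory vertices of $G$. A graph is chordal if it has no induced cycle of length at least $4$. -}

module Defs where

open import Level using (Level; _⊔_; 0ℓ) renaming (suc to lsuc)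
open import Data.Nat using (ℕ; zero; suc; _≤_)
open import Data.Nat.DivMod using (_mod_)
open import Data.Fin using (Fin; toℕ)
open import Data.Bool using (Bool; true; false)
open import Data.Product using (Σ; ∃; _×_; _,_)
open import Data.Sum using (_⊎_)
open import Relation.Binary.PropositionalEquality using (_≡_)
open import Relation.Nullary using (¬_)
open import Relation.Unary using (Pred)
open import Function.Definitions using (Injective)

record Graph (n : ℕ) : Set where
  field
    adj     : Fin n → Fin n → Bool
    adj-sym : ∀ u v → adj u v ≡ adj v u
    adj-irr : ∀ v → adj v v ≡ false

module _ {n : ℕ} (G : Graph n) where
  open Graph G

  data Walk : Fin n → Fin n → ℕ → Set where
    []  : ∀ {a} → Walk a a 0
    step : ∀ {a c k} (b : Fin n) → adj a b ≡ true → Walk b c k → Walk a c (suc k)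

  data EdgeOn (u v : Fin n) : ∀ {a b k} → Walk a b k → Set where
    here-uv : ∀ {c k} {p : adj u v ≡ true} {w : Walk v c k} → EdgeOn u v (step v p w)
    here-vu : ∀ {c k} {p : adj v u ≡ true} {w : Walk u c k} → EdgeOn u v (step u p w)
    there   : ∀ {a b c k} {p : adj a b ≡ true} {w : Walk b c k} →
              EdgeOn u v w → EdgeOn u v (step b p w)

  Shortest : ∀ {a b k} → Walk a b k → Set
  Shortest {a} {b} {k} _ = ∀ k' → Walk a b k' → k ≤ k'

  Connected : Set
  Connected = ∀ a b → ∃ λ k → Walk a b k

  Monitors : Fin n → Fin n → Fin n → Fin n → Set
  Monitors a b u v = ∀ {k} (w : Walk a b k) → Shortest w → EdgeOn u v w

  MonitorsEdge : ∀ {ℓ} → Pred (Fin n) ℓ → Fin n → Fin n → Set ℓ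
  MonitorsEdge M u v = Σ (Fin n) λ a → Σ (Fin n) λ b → M a × M b × Monitors a b u v

  IsMEG : ∀ {ℓ} → Pred (Fin n) ℓ → Set ℓ
  IsMEG M = ∀ u v → adj u v ≡ true → MonitorsEdge M u v

  Mand : Pred (Fin n) (lsuc 0ℓ)
  Mand x = (M : Pred (Fin n) 0ℓ) → IsMEG M → M x

  next : ∀ {m} → Fin (suc m) → Fin (suc m)
  next {m} i = suc (toℕ i) mod (suc m)

  record InducedCycle (m : ℕ) : Set where
    field
      vtx      : Fin (suc m) → Fin n
      vtx-inj  : Injective _≡_ _≡_ vtx
      cyc-edge : ∀ i → adj (vtx i) (vtx (next i)) ≡ true
      no-chord : ∀ i j → adj (vtx i) (vtx j) ≡ true → (j ≡ next i) ⊎ (i ≡ next j)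

  Chordal : Set
  Chordal = ∀ m → 4 ≤ suc m → ¬ InducedCycle m

{-# OPTIONS --safe #-}
-- Levels are distances to a fixed target t, and a parent of a vertex is a neighbour one
-- level closer to t. Call a vertex a with neighbour c bypassable if every induced path
-- x–a–c lies on a 4-cycle x–a–c–y; then a is mandatory, since a geodesic through the edge ac
-- with a in its interior can be rerouted through y.
--
-- If {s, t} monitors an edge at s, then that edge joins s to its unique parent x. If s is
-- not bypassable with neighbour x, a witness lies one level further from t and has s as its
-- unique parent, so together with t it still monitors the edge; as levels are bounded, this
-- climb ends at a mandatory vertex. For an edge uv, climbing from {u, v} gives a mandatory a
-- with {a, v} monitoring uv, and climbing from {v, a} a mandatory b with {b, a} monitoring uv.
--
-- Chordality enters through one fact: two vertices of level i joined by a walk that stays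
-- above level i in between are adjacent. Otherwise a shortest such walk, closed up through
-- their parents (adjacent by the same fact one level lower), is a chordless cycle of length
-- at least 4. Hence the parents of a vertex form a clique and adjacent vertices of one level
-- share a parent, which is what keeps parents unique during the climb.
module Submission where

open import Defs
open import Level using (0ℓ)
open import Data.Bool using (Bool; true; false; _∧_)
import Data.Bool.Properties as Bool
open import Data.Empty using (⊥; ⊥-elim)
open import Data.Fin using (Fin; toℕ; _≟_)
import Data.Fin.Properties as Fin
open import Data.List using (map; allFin)
open import Data.List.Extrema.Nat using (max; xs≤max)
open import Data.List.Membership.Propositional.Properties using (∈-map⁺; ∈-allFin)
open import Data.List.Relation.Unary.All using (lookup)
open import Data.Nat using (ℕ; zero; suc; _+_; _∸_; _%_; _≤_; _<_; z≤n; s≤s; _≤?_; _<?_)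
open import Data.Nat.DivMod using (m<n⇒m%n≡m; n%n≡0)
open import Data.Nat.Properties hiding (_≟_)
open import Data.Product using (Σ; ∃; ∃₂; _×_; _,_; proj₁; proj₂)
open import Data.Sum using (_⊎_; inj₁; inj₂; [_,_]′)
import Data.Sum as Sum
open import Function using (_∘_)
open import Relation.Binary.PropositionalEquality
open import Relation.Binary.Definitions using (tri<; tri≈; tri>)
open import Relation.Nullary using (¬_; Dec; yes; no; does; contradiction)
open import Relation.Nullary.Decidable using (map′; _×-dec_; _⊎-dec_; ¬?; decidable-stable)
open import Relation.Unary using (Pred; Decidable)

record BoundedMinimum (P : Pred ℕ 0ℓ) (B : ℕ) : Set where
  field
    value    : ℕ
    bounded  : value ≤ suc B
    minimal  : ∀ {j} → j < value → ¬ P j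
    attained : value ≤ B → P value

boundedMinimum : ∀ {P} → Decidable P → ∀ B → BoundedMinimum P B
boundedMinimum P? zero with P? zero
... | yes p₀ = record { value = 0 ; bounded = z≤n ; minimal = λ () ; attained = λ _ → p₀ }
... | no ¬p₀ = record
  { value = 1 ; bounded = ≤-refl ; minimal = λ { (s≤s z≤n) → ¬p₀ } ; attained = λ () }
boundedMinimum {P} P? (suc B) = extend (boundedMinimum P? B)
  where
  extend : BoundedMinimum P B → BoundedMinimum P (suc B)
  extend record { value = m ; bounded = m≤1+B ; minimal = below ; attained = hit }
    with m≤n⇒m<n∨m≡n m≤1+B
  ... | inj₁ m<1+B = record
    { value = m ; bounded = m≤n⇒m≤1+n m≤1+B ; minimal = below ; attained = λ _ → hit (≤-pred m<1+B) }
  ... | inj₂ refl with P? (suc B)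
  ...   | yes p = record { value = suc B ; bounded = n≤1+n _ ; minimal = below ; attained = λ _ → p }
  ...   | no ¬p = record
    { value    = suc (suc B)
    ; bounded  = ≤-refl
    ; minimal  = λ j<2+B → [ below , (λ { refl → ¬p }) ]′ (m<1+n⇒m<n∨m≡n j<2+B)
    ; attained = λ 2+B≤1+B → contradiction 2+B≤1+B 1+n≰n }

∸≤1+∸⇒≤1+ : ∀ {i j k} → i ≤ k → j ≤ k → k ∸ i ≤ suc (k ∸ j) → j ≤ suc i
∸≤1+∸⇒≤1+ {i} {j} {k} i≤k j≤k gap = +-cancelˡ-≤ (k ∸ j) j (suc i) (begin
  k ∸ j + j       ≡⟨ m∸n+n≡m j≤k ⟩
  k               ≡⟨ m∸n+n≡m i≤k ⟨
  k ∸ i + i       ≤⟨ +-monoˡ-≤ i gap ⟩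
  suc (k ∸ j) + i ≡⟨ +-suc (k ∸ j) i ⟨
  k ∸ j + suc i   ∎)
  where open ≤-Reasoning

∸-close⇒consecutive : ∀ {i j k} → i ≤ k → j ≤ k → i ≢ j →
                      k ∸ i ≤ suc (k ∸ j) → k ∸ j ≤ suc (k ∸ i) → suc i ≡ j ⊎ suc j ≡ i
∸-close⇒consecutive {i} {j} i≤k j≤k i≢j gap gap′ with <-cmp i j
... | tri< i<j _ _ = inj₁ (≤-antisym i<j (∸≤1+∸⇒≤1+ i≤k j≤k gap))
... | tri≈ _ i≡j _ = contradiction i≡j i≢j
... | tri> _ _ j<i = inj₂ (≤-antisym j<i (∸≤1+∸⇒≤1+ j≤k i≤k gap′))

module Walks {n} (G : Graph n) where
  open Graph G

  private
    variable
      a b c s u v y : Fin n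
      j k : ℕ

  infix 4 _∼_ _∼?_

  _∼_ : Fin n → Fin n → Set
  u ∼ v = adj u v ≡ true

  _∼?_ : ∀ u v → Dec (u ∼ v)
  u ∼? v = adj u v Bool.≟ true

  ∼-sym : u ∼ v → v ∼ u
  ∼-sym {u} {v} h = trans (adj-sym v u) h

  ∼-irrefl : u ∼ v → u ≢ v
  ∼-irrefl {u} h refl with () ← trans (sym h) (adj-irr u)

  snoc : Walk G a b k → b ∼ c → Walk G a c (suc k)
  snoc []           h = step _ h []
  snoc (step x p w) h = step x p (snoc w h)

  reverse : Walk G a b k → Walk G b a k
  reverse []           = []
  reverse (step x p w) = snoc (reverse w) (∼-sym p)

  two≤length : a ≢ b → ¬ a ∼ b → Walk G a b k → 2 ≤ k
  two≤length a≢b _   []                      = contradiction refl a≢b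
  two≤length _   a≁b (step _ a∼b [])         = contradiction a∼b a≁b
  two≤length _   _   (step _ _ (step _ _ _)) = s≤s (s≤s z≤n)

  -- Positions beyond the end of a walk give its last vertex.
  pos : Walk G a b k → ℕ → Fin n
  pos {a} _            zero    = a
  pos {a} []           (suc j) = a
  pos     (step _ _ w) (suc j) = pos w j

  pos-beyond : (w : Walk G a b k) → ∀ {j} → k ≤ j → pos w j ≡ b
  pos-beyond []           {zero}  _         = refl
  pos-beyond []           {suc j} _         = refl
  pos-beyond (step _ _ w) {suc j} (s≤s k≤j) = pos-beyond w k≤j

  pos-end : (w : Walk G a b k) → pos w k ≡ b
  pos-end w = pos-beyond w ≤-refl

  pos-∼ : (w : Walk G a b k) → ∀ {j} → j < k → pos w j ∼ pos w (suc j)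
  pos-∼ (step _ p w) {zero}  _         = p
  pos-∼ (step _ p w) {suc j} (s≤s j<k) = pos-∼ w j<k

  pos-snoc : (w : Walk G a b k) (h : b ∼ c) → ∀ {j} → j ≤ k → pos (snoc w h) j ≡ pos w j
  pos-snoc _            h {zero}  _         = refl
  pos-snoc (step _ _ w) h {suc j} (s≤s j≤k) = pos-snoc w h j≤k

  data SnocPosition (k : ℕ) : ℕ → Set where
    old : j ≤ k → SnocPosition k j
    new : SnocPosition k (suc k)

  snocPosition : j ≤ suc k → SnocPosition k j
  snocPosition j≤1+k with m≤n⇒m<n∨m≡n j≤1+k
  ... | inj₁ j<1+k = old (≤-pred j<1+k)
  ... | inj₂ refl  = new

  record IsInducedPath (P : Walk G a b k) : Set where
    field
      injective : ∀ {i j} → i ≤ k → j ≤ k → pos P i ≡ pos P j → i ≡ j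
      chordless : ∀ {i j} → i ≤ k → j ≤ k → pos P i ∼ pos P j → suc i ≡ j ⊎ suc j ≡ i

  []-induced : IsInducedPath ([] {a = a})
  []-induced = record
    { injective = λ { z≤n z≤n _ → refl } ; chordless = λ { z≤n z≤n h → ⊥-elim (∼-irrefl h refl) } }

  snoc-injective : (P : Walk G a b k) (h : b ∼ c) →
                   (∀ {i j} → i ≤ k → j ≤ k → pos P i ≡ pos P j → i ≡ j) →
                   (∀ {j} → j ≤ k → pos P j ≢ c) →
                   ∀ {i j} → i ≤ suc k → j ≤ suc k → pos (snoc P h) i ≡ pos (snoc P h) j → i ≡ j
  snoc-injective P h injective c∉P i≤ j≤ eq with snocPosition i≤ | snocPosition j≤
  ... | old i≤k | old j≤k = injective i≤k j≤k (subst₂ _≡_ (pos-snoc P h i≤k) (pos-snoc P h j≤k) eq)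
  ... | old i≤k | new     = ⊥-elim (c∉P i≤k (subst₂ _≡_ (pos-snoc P h i≤k) (pos-end (snoc P h)) eq))
  ... | new     | old j≤k =
    ⊥-elim (c∉P j≤k (subst₂ _≡_ (pos-snoc P h j≤k) (pos-end (snoc P h)) (sym eq)))
  ... | new     | new     = refl

  snoc-induced : {P : Walk G a b k} → IsInducedPath P → (h : b ∼ c) →
                 (∀ {j} → j ≤ k → pos P j ≢ c) → (∀ {j} → j ≤ k → pos P j ∼ c → j ≡ k) →
                 IsInducedPath (snoc P h)
  snoc-induced {k = k} {P = P} induced h c∉P c-touches = record
    { injective = snoc-injective P h (IsInducedPath.injective induced) c∉P ; chordless = chordless }
    where
    last-touch : ∀ {j} → j ≤ k → pos (snoc P h) j ∼ pos (snoc P h) (suc k) → j ≡ k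
    last-touch j≤k j∼c = c-touches j≤k (subst₂ _∼_ (pos-snoc P h j≤k) (pos-end (snoc P h)) j∼c)
    chordless : ∀ {i j} → i ≤ suc k → j ≤ suc k → pos (snoc P h) i ∼ pos (snoc P h) j →
                suc i ≡ j ⊎ suc j ≡ i
    chordless i≤ j≤ i∼j with snocPosition i≤ | snocPosition j≤
    ... | old i≤k | old j≤k = IsInducedPath.chordless induced i≤k j≤k
                                (subst₂ _∼_ (pos-snoc P h i≤k) (pos-snoc P h j≤k) i∼j)
    ... | old i≤k | new     = inj₁ (cong suc (last-touch i≤k i∼j))
    ... | new     | old j≤k = inj₂ (cong suc (last-touch j≤k (∼-sym i∼j)))
    ... | new     | new     = ⊥-elim (∼-irrefl i∼j refl)

  EdgeOn-step⁻ : {p : s ∼ y} {w : Walk G y b k} → EdgeOn G u v (step y p w) →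
                 (s ≡ u × y ≡ v) ⊎ (s ≡ v × y ≡ u) ⊎ EdgeOn G u v w
  EdgeOn-step⁻ here-uv   = inj₁ (refl , refl)
  EdgeOn-step⁻ here-vu   = inj₂ (inj₁ (refl , refl))
  EdgeOn-step⁻ (there e) = inj₂ (inj₂ e)

  EdgeOn-sym : {w : Walk G a b k} → EdgeOn G u v w → EdgeOn G v u w
  EdgeOn-sym here-uv   = here-vu
  EdgeOn-sym here-vu   = here-uv
  EdgeOn-sym (there e) = there (EdgeOn-sym e)

  EdgeOn-step-avoid : {p : s ∼ y} {w : Walk G y b k} → s ≢ u → y ≢ u →
                      ¬ EdgeOn G u v w → ¬ EdgeOn G u v (step y p w)
  EdgeOn-step-avoid s≢u y≢u e∉w e with EdgeOn-step⁻ e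
  ... | inj₁ (s≡u , _)        = s≢u s≡u
  ... | inj₂ (inj₁ (_ , y≡u)) = y≢u y≡u
  ... | inj₂ (inj₂ e′)        = e∉w e′

  EdgeOn-snoc⁻ : (w : Walk G a b k) (h : b ∼ c) → EdgeOn G u v (snoc w h) →
                 EdgeOn G u v w ⊎ (u ≡ b × v ≡ c) ⊎ (u ≡ c × v ≡ b)
  EdgeOn-snoc⁻ []           h here-uv   = inj₂ (inj₁ (refl , refl))
  EdgeOn-snoc⁻ []           h here-vu   = inj₂ (inj₂ (refl , refl))
  EdgeOn-snoc⁻ (step x p w) h here-uv   = inj₁ here-uv
  EdgeOn-snoc⁻ (step x p w) h here-vu   = inj₁ here-vu
  EdgeOn-snoc⁻ (step x p w) h (there e) with EdgeOn-snoc⁻ w h e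
  ... | inj₁ e′     = inj₁ (there e′)
  ... | inj₂ at-end = inj₂ at-end

  EdgeOn-reverse⁻ : (w : Walk G a b k) → EdgeOn G u v (reverse w) → EdgeOn G u v w
  EdgeOn-reverse⁻ (step x p w) e with EdgeOn-snoc⁻ (reverse w) (∼-sym p) e
  ... | inj₁ e′                    = there (EdgeOn-reverse⁻ w e′)
  ... | inj₂ (inj₁ (refl , refl)) = here-vu
  ... | inj₂ (inj₂ (refl , refl)) = here-uv

module Monitoring {n} (G : Graph n) where
  open Walks G

  private
    variable
      a b c s u v : Fin n

  monitors-sym : Monitors G a b u v → Monitors G b a u v
  monitors-sym m w shortest = EdgeOn-reverse⁻ w (m (reverse w) λ k′ w′ → shortest k′ (reverse w′))

  monitors-flip : Monitors G a b u v → Monitors G a b v u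
  monitors-flip m w shortest = EdgeOn-sym (m w shortest)

  monitors-own-edge : u ∼ v → Monitors G u v u v
  monitors-own-edge u∼v []                      _        = ⊥-elim (∼-irrefl u∼v refl)
  monitors-own-edge u∼v (step _ _ [])           _        = here-uv
  monitors-own-edge u∼v (step _ _ (step _ _ _)) shortest with s≤s () ← shortest 1 (step _ u∼v [])

  Bypassable : Fin n → Fin n → Set
  Bypassable a c = ∀ x → a ∼ x → x ≢ c → ¬ x ∼ c → ∃ λ y → y ≢ a × x ∼ y × y ∼ c

  Unbypassed : Fin n → Fin n → Fin n → Set
  Unbypassed a c x = a ∼ x × x ≢ c × ¬ x ∼ c × ¬ ∃ λ y → y ≢ a × x ∼ y × y ∼ c

  private
    bypass? : ∀ a c x → Dec (∃ λ y → y ≢ a × x ∼ y × y ∼ c)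
    bypass? a c x = Fin.any? λ y → ¬? (y ≟ a) ×-dec x ∼? y ×-dec y ∼? c

  bypassable? : ∀ a c → Bypassable a c ⊎ ∃ (Unbypassed a c)
  bypassable? a c
    with Fin.any? (λ x → a ∼? x ×-dec ¬? (x ≟ c) ×-dec ¬? (x ∼? c) ×-dec ¬? (bypass? a c x))
  ... | yes unbypassed = inj₂ unbypassed
  ... | no ¬unbypassed = inj₁ λ x a∼x x≢c x≁c →
    decidable-stable (bypass? a c x) λ ¬bypass → ¬unbypassed (x , a∼x , x≢c , x≁c , ¬bypass)

  bypass-at : Bypassable a c → s ∼ a → a ∼ v → s ≢ v → ¬ s ∼ v → c ≡ s ⊎ c ≡ v →
              ∃ λ y → y ≢ a × s ∼ y × y ∼ v
  bypass-at bypassable s∼a a∼v s≢v s≁v (inj₁ refl)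
    with y , y≢a , v∼y , y∼s ← bypassable _ a∼v (s≢v ∘ sym) (s≁v ∘ ∼-sym)
    = y , y≢a , ∼-sym y∼s , ∼-sym v∼y
  bypass-at bypassable s∼a a∼v s≢v s≁v (inj₂ refl) = bypassable _ (∼-sym s∼a) s≢v s≁v

module Distance {n} (H : Graph n) (t : Fin n) (B : ℕ) where
  open Walks H

  private
    variable
      a u v y : Fin n
      k : ℕ

  walk? : ∀ k a → Dec (Walk H a t k)
  walk? zero    a = map′ (λ { refl → [] }) (λ { [] → refl }) (a ≟ t)
  walk? (suc k) a = map′ (λ (c , p , w) → step c p w) (λ { (step c p w) → c , p , w })
                         (Fin.any? λ c → a ∼? c ×-dec walk? k c)

  private
    minimum : ∀ a → BoundedMinimum (λ k → Walk H a t k) B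
    minimum a = boundedMinimum (λ k → walk? k a) B

  -- The distance from a to t, or suc B if it exceeds B.
  dist : Fin n → ℕ
  dist a = BoundedMinimum.value (minimum a)

  dist≤1+B : ∀ a → dist a ≤ suc B
  dist≤1+B a = BoundedMinimum.bounded (minimum a)

  geodesic : dist a ≤ B → Walk H a t (dist a)
  geodesic {a} = BoundedMinimum.attained (minimum a)

  dist-minimal : Walk H a t k → dist a ≤ k
  dist-minimal {a} w = ≮⇒≥ λ k<dist → BoundedMinimum.minimal (minimum a) k<dist w

  dist≡0⇒target : dist a ≡ 0 → a ≡ t
  dist≡0⇒target {a} d≡0 = trivial (subst (Walk H a t) d≡0 (geodesic (subst (_≤ B) (sym d≡0) z≤n)))
    where
    trivial : Walk H a t 0 → a ≡ t
    trivial [] = refl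

  dist-∼ : u ∼ v → dist u ≤ suc (dist v)
  dist-∼ {u} {v} u∼v with dist v ≤? B
  ... | yes dv≤B = dist-minimal (step v u∼v (geodesic dv≤B))
  ... | no  dv≰B = ≤-trans (dist≤1+B u) (s≤s (<⇒≤ (≰⇒> dv≰B)))

  geodesic-tail : (p : a ∼ y) (w : Walk H y t k) → suc k ≡ dist a → k ≡ dist y
  geodesic-tail p w 1+k≡da =
    ≤-antisym (≤-pred (subst (_≤ _) (sym 1+k≡da) (dist-∼ p))) (dist-minimal w)

  geodesic-pos : (w : Walk H a t k) → k ≡ dist a → ∀ {j} → j ≤ k → dist (pos w j) ≡ k ∸ j
  geodesic-pos w            k≡da {zero}  _         = sym k≡da
  geodesic-pos (step _ p w) k≡da {suc j} (s≤s j≤k) = geodesic-pos w (geodesic-tail p w k≡da) j≤k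

module Levels {n} (G : Graph n) (conn : Connected G) (t : Fin n) where
  open Walks G
  open Monitoring G

  private
    variable
      a c s u v x y : Fin n
      d k : ℕ

  bound : ℕ
  bound = max 0 (map (λ a → proj₁ (conn a t)) (allFin n))

  open Distance G t bound public

  dist≤bound : ∀ a → dist a ≤ bound
  dist≤bound a = ≤-trans (dist-minimal (proj₂ (conn a t)))
    (lookup (xs≤max 0 (map (λ a → proj₁ (conn a t)) (allFin n))) (∈-map⁺ _ (∈-allFin a)))

  shortest : ∀ a → Walk G a t (dist a)
  shortest a = geodesic (dist≤bound a)

  Shortest⇒≡dist : (w : Walk G a t k) → Shortest G w → k ≡ dist a
  Shortest⇒≡dist {a} w w-shortest = ≤-antisym (w-shortest _ (shortest a)) (dist-minimal w)

  ≡dist⇒Shortest : (w : Walk G a t k) → k ≡ dist a → Shortest G w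
  ≡dist⇒Shortest w k≡da k′ w′ = subst (_≤ k′) (sym k≡da) (dist-minimal w′)

  gap⇒≁ : suc (dist v) < dist u → ¬ u ∼ v
  gap⇒≁ gap u∼v = <⇒≱ gap (dist-∼ u∼v)

  record Parent (a c : Fin n) : Set where
    field
      adjacent : a ∼ c
      closer   : dist a ≡ suc (dist c)

  open Parent public

  geodesic-step : (p : a ∼ y) (w : Walk G y t k) → suc k ≡ dist a → Parent a y
  geodesic-step p w 1+k≡da = record
    { adjacent = p ; closer = trans (sym 1+k≡da) (cong suc (geodesic-tail p w 1+k≡da)) }

  parent : dist a ≡ suc d → ∃ λ c → Parent a c × dist c ≡ d
  parent {a} da≡1+d with subst (Walk G a t) da≡1+d (shortest a)
  ... | step c a∼c w =
    c , geodesic-step a∼c w (sym da≡1+d) , sym (geodesic-tail a∼c w (sym da≡1+d))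

  parent-below : Parent a c → dist c < dist a
  parent-below a→c = ≤-reflexive (sym (closer a→c))

  parent-level : Parent a c → dist a ≡ suc d → dist c ≡ d
  parent-level a→c da≡1+d = suc-injective (trans (sym (closer a→c)) da≡1+d)

  sibling-parent : dist y ≡ dist a → Parent a c → y ∼ c → Parent y c
  sibling-parent dy≡da a→c y∼c = record { adjacent = y∼c ; closer = trans dy≡da (closer a→c) }

  geodesic-edge-below : (w : Walk G s t k) → k ≡ dist s → EdgeOn G u v w → u ≡ s ⊎ dist u < dist s
  geodesic-edge-below (step y p w) k≡ds e with EdgeOn-step⁻ e
  ... | inj₁ (s≡u , _)         = inj₁ (sym s≡u)
  ... | inj₂ (inj₁ (_ , refl)) = inj₂ (parent-below (geodesic-step p w k≡ds))
  ... | inj₂ (inj₂ e′)         = inj₂ ([ (λ { refl → y<s }) , (λ u<y → <-trans u<y y<s) ]′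
                                         (geodesic-edge-below w (geodesic-tail p w k≡ds) e′))
    where y<s = parent-below (geodesic-step p w k≡ds)

  record UniqueParent (a c : Fin n) : Set where
    field
      parentOf : Parent a c
      unique   : ∀ {y} → Parent a y → y ≡ c

  monitors-via-parent : UniqueParent a c → Monitors G c t u v → Monitors G a t u v
  monitors-via-parent {a = a} {u = u} {v = v} up m w w-shortest = go w (Shortest⇒≡dist w w-shortest)
    where
    go : (w : Walk G a t k) → k ≡ dist a → EdgeOn G u v w
    go []            0≡da = contradiction (trans 0≡da (closer (UniqueParent.parentOf up))) λ ()
    go (step y p w′) k≡da with refl ← UniqueParent.unique up (geodesic-step p w′ k≡da) =
      there (m w′ (≡dist⇒Shortest w′ (geodesic-tail p w′ k≡da)))

  monitors⇒unique-parent : Monitors G s t s x → UniqueParent s x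
  monitors⇒unique-parent {s} {x} m =
    let c , s→c = some-parent
    in record { parentOf = subst (Parent s) (unique s→c) s→c ; unique = unique }
    where
    unique : ∀ {y} → Parent s y → y ≡ x
    unique {y} s→y
      with EdgeOn-step⁻ (m (step y (adjacent s→y) (shortest y))
                           (≡dist⇒Shortest (step y (adjacent s→y) (shortest y)) (sym (closer s→y))))
    ... | inj₁ (_ , y≡x)        = y≡x
    ... | inj₂ (inj₁ (_ , y≡s)) = contradiction (sym y≡s) (∼-irrefl (adjacent s→y))
    ... | inj₂ (inj₂ e)         =
      ⊥-elim ([ ∼-irrefl (adjacent s→y) , (λ s<y → <-asym s<y (parent-below s→y)) ]′
                (geodesic-edge-below (shortest y) refl e))
    some-parent : ∃ (Parent s)
    some-parent with dist s in ds≡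
    ... | zero with refl ← dist≡0⇒target ds≡ = contradiction (m [] (≡dist⇒Shortest [] (sym ds≡))) λ ()
    ... | suc d = let c , s→c , _ = parent ds≡ in c , s→c

  -- On a geodesic s → a → v → …, the vertex c is s or v, so a bypass y of a gives the
  -- geodesic s → y → v → …, which avoids a.
  detour : Bypassable a c → (s∼a : s ∼ a) (w : Walk G a t k) → suc k ≡ dist s → s ≢ a → t ≢ a →
           EdgeOn G a c (step a s∼a w) → Σ (Walk G s t (suc k)) λ w′ → ¬ EdgeOn G a c w′
  detour bypassable s∼a [] _ _ t≢a _ = contradiction refl t≢a
  detour {a} {c} {s} bypassable s∼a (step v a∼v rest) 2+k≡ds s≢a _ e =
    let y , y≢a , s∼y , y∼v = bypass-at bypassable s∼a a∼v s≢v (gap⇒≁ gap) c∈sv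
    in step y s∼y (step v y∼v rest) ,
       EdgeOn-step-avoid s≢a y≢a (EdgeOn-step-avoid y≢a (∼-irrefl a∼v ∘ sym) a∉rest)
    where
    1+k≡da = geodesic-tail s∼a (step v a∼v rest) 2+k≡ds
    k≡dv   = geodesic-tail a∼v rest 1+k≡da
    gap : suc (dist v) < dist s
    gap = ≤-reflexive (trans (cong (suc ∘ suc) (sym k≡dv)) 2+k≡ds)
    s≢v : s ≢ v
    s≢v refl = 1+n≰n (≤-trans gap (n≤1+n _))
    a∉rest : ¬ EdgeOn G a c rest
    a∉rest e′ = [ ∼-irrefl a∼v , (λ a<v → <-asym a<v (parent-below (geodesic-step a∼v rest 1+k≡da))) ]′
                  (geodesic-edge-below rest k≡dv e′)
    c∈sv : c ≡ s ⊎ c ≡ v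
    c∈sv with EdgeOn-step⁻ e
    ... | inj₁ (s≡a , _)        = contradiction s≡a s≢a
    ... | inj₂ (inj₁ (s≡c , _)) = inj₁ (sym s≡c)
    ... | inj₂ (inj₂ e′) with EdgeOn-step⁻ e′
    ...   | inj₁ (_ , v≡c)        = inj₂ (sym v≡c)
    ...   | inj₂ (inj₁ (_ , v≡a)) = contradiction (sym v≡a) (∼-irrefl a∼v)
    ...   | inj₂ (inj₂ e″)        = ⊥-elim (a∉rest e″)

  bypass : Bypassable a c → t ≢ a → (w : Walk G s t k) → k ≡ dist s → s ≢ a → EdgeOn G a c w →
           Σ (Walk G s t k) λ w′ → ¬ EdgeOn G a c w′
  bypass {a} bypassable t≢a (step y s∼y w) k≡ds s≢a e with y ≟ a
  ... | yes refl = detour bypassable s∼y w k≡ds s≢a t≢a e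
  ... | no y≢a =
    let w′ , e∉w′ = bypass bypassable t≢a w (geodesic-tail s∼y w k≡ds) y≢a e-in-tail
    in step y s∼y w′ , EdgeOn-step-avoid s≢a y≢a e∉w′
    where
    e-in-tail : EdgeOn G a _ w
    e-in-tail with EdgeOn-step⁻ e
    ... | inj₁ (s≡a , _)        = contradiction s≡a s≢a
    ... | inj₂ (inj₁ (_ , y≡a)) = contradiction y≡a y≢a
    ... | inj₂ (inj₂ e′)        = e′

  bypassable-unmonitored : Bypassable a c → s ≢ a → t ≢ a → ¬ Monitors G s t a c
  bypassable-unmonitored {s = s} bypassable s≢a t≢a m =
    let w′ , e∉w′ = bypass bypassable t≢a (shortest s) refl s≢a
                            (m (shortest s) (≡dist⇒Shortest (shortest s) refl))
    in e∉w′ (m w′ (≡dist⇒Shortest w′ refl))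

module Mandatory {n} (G : Graph n) (conn : Connected G) where
  open Walks G
  open Monitoring G

  bypassable⇒mandatory : ∀ {a c} → a ∼ c → Bypassable a c → Mand G a
  bypassable⇒mandatory {a} {c} a∼c bypassable M meg with meg a c a∼c
  ... | p , q , p∈M , q∈M , m with p ≟ a | q ≟ a
  ...   | yes refl | _        = p∈M
  ...   | no _     | yes refl = q∈M
  ...   | no p≢a   | no q≢a   = ⊥-elim (Levels.bypassable-unmonitored G conn q bypassable p≢a q≢a m)

module Subgraph {n} (G : Graph n) {S : Pred (Fin n) 0ℓ} (S? : Decidable S) where
  open Graph G
  open Walks G

  private
    variable
      a b u v x y : Fin n
      k : ℕ

    adjS : Fin n → Fin n → Bool
    adjS u v = does (S? u) ∧ (does (S? v) ∧ adj u v)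

    adjS-sym : ∀ u v → adjS u v ≡ adjS v u
    adjS-sym u v with S? u | S? v
    ... | yes _ | yes _ = adj-sym u v
    ... | yes _ | no  _ = refl
    ... | no  _ | yes _ = refl
    ... | no  _ | no  _ = refl

    adjS-irr : ∀ v → adjS v v ≡ false
    adjS-irr v with S? v
    ... | yes _ = adj-irr v
    ... | no  _ = refl

  H : Graph n
  H = record { adj = adjS ; adj-sym = adjS-sym ; adj-irr = adjS-irr }

  module H = Walks H

  ∼⇒∼H : S u → S v → u ∼ v → u H.∼ v
  ∼⇒∼H {u} {v} Su Sv u∼v with S? u | S? v
  ... | yes _  | yes _  = u∼v
  ... | no ¬Su | _      = contradiction Su ¬Su
  ... | yes _  | no ¬Sv = contradiction Sv ¬Sv

  ∼H⇒∼ : u H.∼ v → S u × S v × u ∼ v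
  ∼H⇒∼ {u} {v} h with S? u | S? v
  ... | yes Su | yes Sv = Su , Sv , h
  ... | yes _  | no _   with () ← h
  ... | no _   | _      with () ← h

  fromH : Walk H a b k → Walk G a b k
  fromH []           = []
  fromH (step x h w) = step x (proj₂ (proj₂ (∼H⇒∼ h))) (fromH w)

  pos-fromH : (w : Walk H a b k) → ∀ j → pos (fromH w) j ≡ H.pos w j
  pos-fromH _            zero    = refl
  pos-fromH []           (suc j) = refl
  pos-fromH (step _ _ w) (suc j) = pos-fromH w j

  toH : (w : Walk G a b k) → (∀ j → S (pos w j)) → Walk H a b k
  toH []           _     = []
  toH (step x p w) S-pos = step x (∼⇒∼H (S-pos 0) (S-pos 1) p) (toH w (S-pos ∘ suc))

  H-pos-S : S a → (w : Walk H a b k) → ∀ j → S (H.pos w j)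
  H-pos-S Sa _            zero    = Sa
  H-pos-S Sa []           (suc j) = Sa
  H-pos-S Sa (step _ h w) (suc j) = H-pos-S (proj₁ (proj₂ (∼H⇒∼ h))) w j

  -- On a geodesic to y inside S, position j is at distance k ∸ j from y, while the ends of
  -- a chord, both in S, differ in distance by at most one.
  induced-subpath : ∀ {K} (w : Walk G x y K) → (∀ j → S (pos w j)) →
                    ∃₂ λ k (P : Walk G x y k) → IsInducedPath P × (∀ j → S (pos P j))
  induced-subpath {x} {y} {K} w S-pos = δ x , P , induced , S-posP
    where
    open Distance H y K renaming (dist to δ)
    P′ : Walk H x y (δ x)
    P′ = geodesic (dist-minimal (toH w S-pos))
    P = fromH P′
    S-posP : ∀ j → S (pos P j)
    S-posP j = subst S (sym (pos-fromH P′ j)) (H-pos-S (S-pos 0) P′ j)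
    δ-pos : ∀ {j} → j ≤ δ x → δ (pos P j) ≡ δ x ∸ j
    δ-pos {j} j≤ = trans (cong δ (pos-fromH P′ j)) (geodesic-pos P′ refl j≤)
    gap : ∀ {i j} → i ≤ δ x → j ≤ δ x → pos P i ∼ pos P j → δ x ∸ i ≤ suc (δ x ∸ j)
    gap {i} {j} i≤ j≤ i∼j = subst₂ (λ di dj → di ≤ suc dj) (δ-pos i≤) (δ-pos j≤)
                                   (dist-∼ (∼⇒∼H (S-posP i) (S-posP j) i∼j))
    induced : IsInducedPath P
    induced = record
      { injective = λ i≤ j≤ eq →
          ∸-cancelˡ-≡ i≤ j≤ (trans (sym (δ-pos i≤)) (trans (cong δ eq) (δ-pos j≤)))
      ; chordless = λ i≤ j≤ i∼j →
          ∸-close⇒consecutive i≤ j≤ (∼-irrefl i∼j ∘ cong (pos P))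
                              (gap i≤ j≤ i∼j) (gap j≤ i≤ (∼-sym i∼j)) }

module Cycles {n} (G : Graph n) (chordal : Chordal G) where
  open Walks G

  private
    variable
      w x y : Fin n
      k m : ℕ

  Follows : ℕ → ℕ → ℕ → Set
  Follows m i j = suc i ≡ j ⊎ (i ≡ m × j ≡ 0)

  private
    toℕ-next : (i : Fin (suc m)) → toℕ i < m → toℕ (next G i) ≡ suc (toℕ i)
    toℕ-next i i<m = trans (Fin.toℕ-fromℕ< _) (m<n⇒m%n≡m (s≤s i<m))

    toℕ-next-last : (i : Fin (suc m)) → toℕ i ≡ m → toℕ (next G i) ≡ 0
    toℕ-next-last {m} i i≡m =
      trans (Fin.toℕ-fromℕ< _) (trans (cong (λ j → suc j % suc m) i≡m) (n%n≡0 (suc m)))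

    Follows⇒next : (i j : Fin (suc m)) → Follows m (toℕ i) (toℕ j) → j ≡ next G i
    Follows⇒next {m} i j (inj₁ 1+i≡j) = Fin.toℕ-injective (trans (sym 1+i≡j) (sym (toℕ-next i i<m)))
      where i<m = subst (_≤ m) (sym 1+i≡j) (Fin.toℕ≤pred[n] j)
    Follows⇒next i j (inj₂ (i≡m , j≡0)) = Fin.toℕ-injective (trans j≡0 (sym (toℕ-next-last i i≡m)))

  no-long-cycle : (C : Walk G x y m) → 3 ≤ m → y ∼ x →
                  (∀ {i j} → i ≤ m → j ≤ m → pos C i ≡ pos C j → i ≡ j) →
                  (∀ {i j} → i ≤ m → j ≤ m → pos C i ∼ pos C j → Follows m i j ⊎ Follows m j i) → ⊥
  no-long-cycle {m = m} C 3≤m y∼x injective chords = chordal m (s≤s 3≤m) record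
    { vtx      = vtx
    ; vtx-inj  = λ eq → Fin.toℕ-injective (injective (≤m _) (≤m _) eq)
    ; cyc-edge = edge
    ; no-chord = λ i j i∼j →
        Sum.map (Follows⇒next i j) (Follows⇒next j i) (chords (≤m i) (≤m j) i∼j) }
    where
    vtx : Fin (suc m) → Fin n
    vtx i = pos C (toℕ i)
    ≤m : (i : Fin (suc m)) → toℕ i ≤ m
    ≤m = Fin.toℕ≤pred[n]
    edge : ∀ i → vtx i ∼ vtx (next G i)
    edge i with m≤n⇒m<n∨m≡n (≤m i)
    ... | inj₁ i<m = subst (λ j → vtx i ∼ pos C j) (sym (toℕ-next i i<m)) (pos-∼ C i<m)
    ... | inj₂ i≡m = subst₂ (λ u j → u ∼ pos C j) (sym (pos-beyond C (≤-reflexive (sym i≡m))))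
                                                  (sym (toℕ-next-last i i≡m)) y∼x

  no-closing-vertex : {P : Walk G x y k} → IsInducedPath P → 2 ≤ k → (h : y ∼ w) → w ∼ x →
                      (∀ {j} → j ≤ k → pos P j ≢ w) →
                      (∀ {j} → j ≤ k → pos P j ∼ w → j ≡ 0 ⊎ j ≡ k) → ⊥
  no-closing-vertex {k = k} {P = P} induced 2≤k h w∼x w∉P w-touches =
    no-long-cycle (snoc P h) (s≤s 2≤k) w∼x
                  (snoc-injective P h (IsInducedPath.injective induced) w∉P) chords
    where
    closing : ∀ {j} → j ≤ k → pos (snoc P h) j ∼ pos (snoc P h) (suc k) →
              Follows (suc k) j (suc k) ⊎ Follows (suc k) (suc k) j
    closing j≤k j∼w with w-touches j≤k (subst₂ _∼_ (pos-snoc P h j≤k) (pos-end (snoc P h)) j∼w)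
    ... | inj₁ j≡0 = inj₂ (inj₂ (refl , j≡0))
    ... | inj₂ j≡k = inj₁ (inj₁ (cong suc j≡k))
    chords : ∀ {i j} → i ≤ suc k → j ≤ suc k → pos (snoc P h) i ∼ pos (snoc P h) j →
             Follows (suc k) i j ⊎ Follows (suc k) j i
    chords i≤ j≤ i∼j with snocPosition i≤ | snocPosition j≤
    ... | old i≤k | old j≤k = Sum.map inj₁ inj₁ (IsInducedPath.chordless induced i≤k j≤k
                                (subst₂ _∼_ (pos-snoc P h i≤k) (pos-snoc P h j≤k) i∼j))
    ... | old i≤k | new     = closing i≤k i∼j
    ... | new     | old j≤k = Sum.swap (closing j≤k (∼-sym i∼j))
    ... | new     | new     = ⊥-elim (∼-irrefl i∼j refl)

module ChordalLevels {n} (G : Graph n) (conn : Connected G) (chordal : Chordal G) (t : Fin n) where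
  open Walks G
  open Monitoring G
  open Levels G conn t
  open Cycles G chordal
  open Mandatory G conn

  private
    variable
      a c s u v x x′ y y′ z : Fin n
      d i k : ℕ

  record Arch (i : ℕ) (P : Walk G x y k) : Set where
    field
      start : dist x ≡ suc i
      end   : dist y ≡ suc i
      inner : ∀ {j} → 0 < j → j < k → suc i < dist (pos P j)

  Arch-above : {P : Walk G x y k} → Arch i P → ∀ j → suc i ≤ dist (pos P j)
  Arch-above arch zero = ≤-reflexive (sym (Arch.start arch))
  Arch-above {k = k} {P = P} arch (suc j) with suc j <? k
  ... | yes 1+j<k = <⇒≤ (Arch.inner arch (s≤s z≤n) 1+j<k)
  ... | no  1+j≮k = ≤-reflexive (sym (trans (cong dist (pos-beyond P (≮⇒≥ 1+j≮k))) (Arch.end arch)))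

  Arch-avoids : {P : Walk G x y k} → Arch i P → dist v ≡ i → ∀ j → pos P j ≢ v
  Arch-avoids arch dv≡i j refl = 1+n≰n (subst (suc _ ≤_) dv≡i (Arch-above arch j))

  Arch-touches : {P : Walk G x y k} → Arch i P → dist v ≡ i →
                 ∀ {j} → j ≤ k → pos P j ∼ v → j ≡ 0 ⊎ j ≡ k
  Arch-touches arch dv≡i {zero}  _     _   = inj₁ refl
  Arch-touches arch dv≡i {suc j} 1+j≤k j∼v with m≤n⇒m<n∨m≡n 1+j≤k
  ... | inj₁ 1+j<k =
    ⊥-elim (gap⇒≁ (subst (λ d → suc d < _) (sym dv≡i) (Arch.inner arch (s≤s z≤n) 1+j<k)) j∼v)
  ... | inj₂ 1+j≡k = inj₂ 1+j≡k

  arch-closing : {P : Walk G x y k} → IsInducedPath P → Arch i P → 2 ≤ k →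
                 dist v ≡ i → y ∼ v → v ∼ x → ⊥
  arch-closing induced arch 2≤k dv≡i y∼v v∼x =
    no-closing-vertex induced 2≤k y∼v v∼x (λ {j} _ → Arch-avoids arch dv≡i j) (Arch-touches arch dv≡i)

  arch-ladder : {P : Walk G x y k} → IsInducedPath P → Arch i P → Parent x x′ → Parent y y′ →
                ¬ y ∼ x′ → ¬ x ∼ y′ → ¬ x′ ∼ y′
  arch-ladder {P = []} _ _ _ y→y′ _ x≁y′ _ = x≁y′ (adjacent y→y′)
  arch-ladder {y = y} {k = suc k} {x′ = x′} {y′ = y′} {P = P} induced arch x→x′ y→y′ y≁x′ x≁y′ x′∼y′ =
    no-closing-vertex (snoc-induced induced y∼y′ (λ {j} _ → Arch-avoids arch dy′≡i j) y′-touches)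
                      (s≤s (s≤s z≤n)) (∼-sym x′∼y′) (∼-sym (adjacent x→x′)) x′-avoids x′-touches
    where
    y∼y′  = adjacent y→y′
    dx′≡i = parent-level x→x′ (Arch.start arch)
    dy′≡i = parent-level y→y′ (Arch.end arch)
    y′-touches : ∀ {j} → j ≤ suc k → pos P j ∼ y′ → j ≡ suc k
    y′-touches j≤ j∼y′ with Arch-touches arch dy′≡i j≤ j∼y′
    ... | inj₁ refl = contradiction j∼y′ x≁y′
    ... | inj₂ j≡k  = j≡k
    x′-avoids : ∀ {j} → j ≤ suc (suc k) → pos (snoc P y∼y′) j ≢ x′
    x′-avoids {j} j≤ with snocPosition j≤
    ... | old j≤k = Arch-avoids arch dx′≡i j ∘ trans (sym (pos-snoc P y∼y′ j≤k))
    ... | new     = λ y′≡x′ → y≁x′ (subst (y ∼_) (trans (sym (pos-end (snoc P y∼y′))) y′≡x′) y∼y′)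
    x′-touches : ∀ {j} → j ≤ suc (suc k) → pos (snoc P y∼y′) j ∼ x′ → j ≡ 0 ⊎ j ≡ suc (suc k)
    x′-touches j≤ j∼x′ with snocPosition j≤
    ... | new     = inj₂ refl
    ... | old j≤k with Arch-touches arch dx′≡i j≤k (subst (_∼ x′) (pos-snoc P y∼y′ j≤k) j∼x′)
    ...   | inj₁ j≡0 = inj₁ j≡0
    ...   | inj₂ refl =
      contradiction (subst (_∼ x′) (trans (pos-snoc P y∼y′ j≤k) (pos-end P)) j∼x′) y≁x′

  Above : ℕ → Fin n → Fin n → Pred (Fin n) 0ℓ
  Above i x y v = i < dist v ⊎ v ≡ x ⊎ v ≡ y

  above? : ∀ i x y → Decidable (Above i x y)
  above? i x y v = i <? dist v ⊎-dec v ≟ x ⊎-dec v ≟ y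

  SameLevelAdjacency : ℕ → Set
  SameLevelAdjacency i = ∀ {x y k} → dist x ≡ i → dist y ≡ i → x ≢ y →
                         (w : Walk G x y k) → (∀ j → Above i x y (pos w j)) → x ∼ y

  Above⇒Arch : {P : Walk G x y k} → IsInducedPath P → dist x ≡ suc i → dist y ≡ suc i →
               (∀ j → Above (suc i) x y (pos P j)) → Arch i P
  Above⇒Arch {k = k} {i = i} {P = P} induced dx≡ dy≡ P-above =
    record { start = dx≡ ; end = dy≡ ; inner = inner }
    where
    open IsInducedPath induced
    inner : ∀ {j} → 0 < j → j < k → suc i < dist (pos P j)
    inner {j} 0<j j<k with P-above j
    ... | inj₁ above       = above
    ... | inj₂ (inj₁ pj≡x) = contradiction (injective (<⇒≤ j<k) z≤n pj≡x) (>⇒≢ 0<j)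
    ... | inj₂ (inj₂ pj≡y) =
      contradiction (injective (<⇒≤ j<k) ≤-refl (trans pj≡y (sym (pos-end P)))) (<⇒≢ j<k)

  -- Otherwise the two parents, adjacent by SameLevelAdjacency i, close the arch into a
  -- chordless cycle of length at least 4.
  arch-parents : SameLevelAdjacency i → {P : Walk G x y k} → IsInducedPath P → Arch i P →
                 Parent x x′ → Parent y y′ → y ∼ x′ ⊎ x ∼ y′
  arch-parents {i} {x} {y} {k} {x′} {y′} adjacency {P} induced arch x→x′ y→y′ with y ∼? x′ | x ∼? y′
  ... | yes y∼x′ | _        = inj₁ y∼x′
  ... | no _     | yes x∼y′ = inj₂ x∼y′
  ... | no y≁x′  | no x≁y′  = ⊥-elim (arch-ladder induced arch x→x′ y→y′ y≁x′ x≁y′ x′∼y′)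
    where
    x′≢y′ : x′ ≢ y′
    x′≢y′ refl = y≁x′ (adjacent y→y′)
    W : Walk G x′ y′ (suc (suc k))
    W = step x (∼-sym (adjacent x→x′)) (snoc P (adjacent y→y′))
    W-above : ∀ j → Above i x′ y′ (pos W j)
    W-above zero = inj₂ (inj₁ refl)
    W-above (suc j) with j ≤? k
    ... | yes j≤k = inj₁ (subst (λ v → i < dist v) (sym (pos-snoc P _ j≤k)) (Arch-above arch j))
    ... | no  j≰k = inj₂ (inj₂ (pos-beyond (snoc P _) (≰⇒> j≰k)))
    x′∼y′ : x′ ∼ y′
    x′∼y′ = adjacency (parent-level x→x′ (Arch.start arch)) (parent-level y→y′ (Arch.end arch))
                      x′≢y′ W W-above

  same-level-adjacent : ∀ i → SameLevelAdjacency i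
  same-level-adjacent zero dx≡0 dy≡0 x≢y _ _ =
    contradiction (trans (dist≡0⇒target dx≡0) (sym (dist≡0⇒target dy≡0))) x≢y
  same-level-adjacent (suc i) {x} {y} dx≡ dy≡ x≢y w w-above with x ∼? y
  ... | yes x∼y = x∼y
  ... | no  x≁y
    with k , P , induced , P-above ← Subgraph.induced-subpath G (above? (suc i) x y) w w-above
       | x′ , x→x′ , dx′≡i ← parent dx≡
       | y′ , y→y′ , dy′≡i ← parent dy≡ =
    let arch = Above⇒Arch induced dx≡ dy≡ P-above
        2≤k  = two≤length x≢y x≁y P
    in ⊥-elim ([ (λ y∼x′ → arch-closing induced arch 2≤k dx′≡i y∼x′ (∼-sym (adjacent x→x′)))
               , (λ x∼y′ → arch-closing induced arch 2≤k dy′≡i (adjacent y→y′) (∼-sym x∼y′)) ]′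
               (arch-parents (same-level-adjacent i) induced arch x→x′ y→y′))

  parents-adjacent : Parent z a → Parent z y → a ≢ y → a ∼ y
  parents-adjacent {z} {a} {y} z→a z→y a≢y =
    same-level-adjacent (dist a) refl (parent-level z→y (closer z→a)) a≢y W W-above
    where
    W = step z (∼-sym (adjacent z→a)) (step y (adjacent z→y) [])
    W-above : ∀ j → Above (dist a) a y (pos W j)
    W-above zero          = inj₂ (inj₁ refl)
    W-above (suc zero)    = inj₁ (parent-below z→a)
    W-above (suc (suc j)) = inj₂ (inj₂ (pos-beyond W {suc (suc j)} (s≤s (s≤s z≤n))))

  common-parent : a ∼ y → dist a ≡ suc d → dist y ≡ suc d → ∃ λ c → Parent a c × Parent y c
  common-parent {y = y} {d = d} a∼y da≡ dy≡ with a′ , a→a′ , _ ← parent da≡ | y′ , y→y′ , _ ← parent dy≡ =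
    [ (λ y∼a′ → a′ , a→a′ , sibling-parent (trans dy≡ (sym da≡)) a→a′ y∼a′)
    , (λ a∼y′ → y′ , sibling-parent (trans da≡ (sym dy≡)) y→y′ a∼y′ , y→y′) ]′
    (arch-parents (same-level-adjacent d) induced arch a→a′ y→y′)
    where
    induced : IsInducedPath (step y a∼y [])
    induced = snoc-induced []-induced a∼y (λ { z≤n → ∼-irrefl a∼y }) (λ { z≤n _ → refl })
    arch : Arch d (step y a∼y [])
    arch = record { start = da≡ ; end = dy≡ ; inner = λ { (s≤s _) (s≤s ()) } }

  unbypassed-unique-parent : UniqueParent a c → Unbypassed a c z → UniqueParent z a
  unbypassed-unique-parent {a} {c} {z} up (a∼z , z≢c , z≁c , no-bypass) =
    record { parentOf = z→a ; unique = z-unique }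
    where
    open UniqueParent up renaming (parentOf to a→c; unique to c-unique)
    shares-c : ∀ {y} → a ∼ y → dist y ≡ dist a → y ∼ c
    shares-c {y} a∼y dy≡da =
      let b , a→b , y→b = common-parent a∼y (closer a→c) (trans dy≡da (closer a→c))
      in subst (y ∼_) (c-unique a→b) (adjacent y→b)
    dz≡ : dist z ≡ suc (dist a)
    dz≡ with <-cmp (dist z) (dist a)
    ... | tri< dz<da _ _ =
      contradiction (c-unique (record { adjacent = a∼z ; closer = ≤-antisym (dist-∼ a∼z) dz<da })) z≢c
    ... | tri≈ _ dz≡da _ = contradiction (shares-c a∼z dz≡da) z≁c
    ... | tri> _ _ da<dz = ≤-antisym (dist-∼ (∼-sym a∼z)) da<dz
    z→a : Parent z a
    z→a = record { adjacent = ∼-sym a∼z ; closer = dz≡ }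
    z-unique : ∀ {y} → Parent z y → y ≡ a
    z-unique {y} z→y with y ≟ a
    ... | yes y≡a = y≡a
    ... | no  y≢a = contradiction (y , y≢a , adjacent z→y , shares-c a∼y dy≡da) no-bypass
      where
      a∼y   = parents-adjacent z→a z→y (y≢a ∘ sym)
      dy≡da = parent-level z→y (closer z→a)

  -- Each step moves one level further from t, so the fuel never runs out.
  climb : ∀ fuel → bound < fuel + dist a → UniqueParent a c → Monitors G a t u v →
          ∃ λ a′ → Mand G a′ × Monitors G a′ t u v
  climb {a} zero over _ _ = contradiction (dist≤bound a) (<⇒≱ over)
  climb {a} {c} (suc fuel) over up m with bypassable? a c
  ... | inj₁ bypassable = a , bypassable⇒mandatory (adjacent (UniqueParent.parentOf up)) bypassable , m
  ... | inj₂ (z , unbypassed) = climb fuel over′ up′ (monitors-via-parent up′ m)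
    where
    up′ = unbypassed-unique-parent up unbypassed
    over′ : bound < fuel + dist z
    over′ = subst (bound <_) (sym (trans (cong (fuel +_) dz≡1+da) (+-suc fuel (dist a)))) over
      where dz≡1+da = closer (UniqueParent.parentOf up′)

  monitored-by-mandatory : Monitors G s t s x → ∃ λ a → Mand G a × Monitors G a t s x
  monitored-by-mandatory {s} m =
    climb (suc bound) (m≤m+n (suc bound) (dist s)) (monitors⇒unique-parent m) m

theorem1 : ∀ {n} (G : Graph n) → Connected G → Chordal G → IsMEG G (Mand G)
theorem1 G conn chordal u v u∼v =
  let a , a-mandatory , av-monitors = monitored-by-mandatory v (monitors-own-edge u∼v)
      b , b-mandatory , ba-monitors = monitored-by-mandatory a (monitors-flip (monitors-sym av-monitors))
  in b , a , b-mandatory , a-mandatory , monitors-flip ba-monitors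
  where
  open Monitoring G
  open ChordalLevels G conn chordal using (monitored-by-mandatory)
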